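{- For every positive integer $n$ there exist a set $S\subseteq\{0,1\}^n$ and a matrix $W\in\{0,1\}^{2\times n}$ such that the projection $\{Wx : x\in{\rm conv}(S)\}\subset\mathbb{R}^2$ of ${\rm conv}(S)$ by $W$ into the plane has more than $\sqrt{\tfrac12 n}$ vertices.
   Formalization: The projected convex hull and its vertices are taken over ℚ rather than ℝ: points of the plane have rational coordinates, and the convex weights and segment parameters in the extreme-point condition are rational. -}

module Defs where

open import Data.Nat as ℕ using (ℕ; zero; suc)
open import Data.Bool using (Bool; true; false)
open import Data.Fin using (Fin; zero; suc)
open import Data.Vec using (Vec; []; _∷_; lookup)
open import Data.List using (List; length; map)
import Data.List as L
open import Data.Rational using (ℚ; 0ℚ; 1ℚ; _+_; _*_; _-_; _≤_; _<_)
import Data.Rational as Q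
open import Data.Product using (Σ; ∃; _×_; _,_; proj₁; proj₂)
open import Relation.Binary.PropositionalEquality using (_≡_)
open import Data.Integer using (+_)

natQ : ℕ → ℚ
natQ k = (+ k) Q./ 1

Point : Set
Point = ℚ × ℚ

sumQ : ∀ {m} → (Fin m → ℚ) → ℚ
sumQ {zero}  f = 0ℚ
sumQ {suc m} f = f zero + sumQ (λ i → f (suc i))

InConv : List Point → Point → Set
InConv P p =
  Σ (Fin (length P) → ℚ) λ w →
    (∀ i → 0ℚ ≤ w i) ×
    sumQ w ≡ 1ℚ ×
    sumQ (λ i → w i * proj₁ (L.lookup P i)) ≡ proj₁ p ×
    sumQ (λ i → w i * proj₂ (L.lookup P i)) ≡ proj₂ p

segPt : ℚ → Point → Point → Point
segPt t (a₁ , a₂) (b₁ , b₂) =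
  (t * a₁ + (1ℚ - t) * b₁ , t * a₂ + (1ℚ - t) * b₂)

IsVertex : List Point → Point → Set
IsVertex P p =
  InConv P p ×
  (∀ (a b : Point) (t : ℚ) → InConv P a → InConv P b →
     0ℚ < t → t < 1ℚ → p ≡ segPt t a b → a ≡ b)

dot : ∀ {n} → Vec Bool n → Vec Bool n → ℕ
dot [] [] = 0
dot (true ∷ u) (true ∷ v) = suc (dot u v)
dot (_ ∷ u) (_ ∷ v) = dot u v

project : ∀ {n} → Vec (Vec Bool n) 2 → Vec Bool n → Point
project W x = (natQ (dot (lookup W zero) x) , natQ (dot (lookup W (suc zero)) x))

image : ∀ {n} → Vec (Vec Bool n) 2 → List (Vec Bool n) → List Point
image W S = map (project W) S

module Submission where

-- The points (j , Δ j), 0 ≤ j ≤ K, with Δ j = j (j − 1) / 2 lie on a convex parabola: (j , Δ j)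
-- maximises both (x , y) ↦ j x − y and (x , y) ↦ (j − 1) x − y over them, and the two maxima
-- pin down a single point of the hull, so each of them is a vertex. They are the images, under
-- the 0/1 matrix whose rows sum the first K and the last R coordinates, of 0/1 vectors with j
-- and Δ j ones in those two blocks, which needs R ≥ Δ K. Taking K largest with K + Δ K ≤ n
-- gives n < Δ (K + 2) ≤ (K + 1)², so the K + 1 vertices are more than √(n / 2).

open import Defs
open import Data.Product using (Σ; ∃-syntax; _×_; _,_; proj₁; proj₂)
open import Function using (_∘_)
open import Relation.Binary.PropositionalEquality
open import Relation.Nullary.Decidable using (dec⇒maybe)
import Data.Rational as ℚ
import Data.Rational.Properties as ℚP
import Tactic.RingSolver.Core.AlmostCommutativeRing as ACR

ℚ-ring : ACR.AlmostCommutativeRing _ _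
ℚ-ring = ACR.fromCommutativeRing ℚP.+-*-commutativeRing (λ x → dec⇒maybe (ℚ.0ℚ ℚP.≟ x))

module Triangular where

  open import Data.Nat
  open import Data.Nat.Properties
  open import Data.Nat.Tactic.RingSolver using (solve-∀)
  open import Data.Sum using (inj₁; inj₂)
  open import Relation.Nullary using (yes; no)

  Δ : ℕ → ℕ
  Δ zero    = 0
  Δ (suc k) = k + Δ k

  Δ-+ : ∀ a b → Δ (a + b) ≡ Δ a + Δ b + a * b
  Δ-+ zero    b = sym (+-identityʳ (Δ b))
  Δ-+ (suc a) b = begin
    a + b + Δ (a + b)            ≡⟨ cong (a + b +_) (Δ-+ a b) ⟩
    a + b + (Δ a + Δ b + a * b)  ≡⟨ rearrange a b (Δ a) (Δ b) ⟩
    a + Δ a + Δ b + (b + a * b)  ∎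
    where
    open ≡-Reasoning
    rearrange : ∀ a b x y → a + b + (x + y + a * b) ≡ a + x + y + (b + a * b)
    rearrange = solve-∀

  Δ[1+n]≤n*n : ∀ n → Δ (suc n) ≤ n * n
  Δ[1+n]≤n*n zero    = z≤n
  Δ[1+n]≤n*n (suc n) = begin
    suc n + Δ (suc n)  ≤⟨ +-monoʳ-≤ (suc n) (Δ[1+n]≤n*n n) ⟩
    suc n + n * n      ≤⟨ +-monoʳ-≤ (suc n) (*-monoʳ-≤ n (n≤1+n n)) ⟩
    suc n + n * suc n  ∎
    where open ≤-Reasoning

  Δ[1+n]≤2*n*n : ∀ n → Δ (suc n) ≤ 2 * n * n
  Δ[1+n]≤2*n*n n = ≤-trans (Δ[1+n]≤n*n n) (≤-trans (m≤n*m (n * n) 2) (≤-reflexive (sym (*-assoc 2 n n))))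

  Δ[n]≤n*n : ∀ n → Δ n ≤ n * n
  Δ[n]≤n*n n = ≤-trans (m≤n+m (Δ n) n) (Δ[1+n]≤n*n n)

  Δ-mono-≤ : ∀ {a b} → a ≤ b → Δ a ≤ Δ b
  Δ-mono-≤ {a} a≤b with d , refl ← m≤n⇒∃[o]m+o≡n a≤b = begin
    Δ a                    ≤⟨ m≤m+n (Δ a) (Δ d) ⟩
    Δ a + Δ d              ≤⟨ m≤m+n (Δ a + Δ d) (a * d) ⟩
    Δ a + Δ d + a * d      ≡⟨ Δ-+ a d ⟨
    Δ (a + d)              ∎
    where open ≤-Reasoning

  -- The parabola lies above its chord of slope j, through (j , Δ j) and (j + 1 , Δ (j + 1)).
  Δ-tangent : ∀ j k → j * k + Δ j ≤ j * j + Δ k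
  Δ-tangent j k with ≤-total j k
  ... | inj₁ j≤k with d , refl ← m≤n⇒∃[o]m+o≡n j≤k = begin
    j * (j + d) + Δ j                ≤⟨ m≤m+n _ (Δ d) ⟩
    j * (j + d) + Δ j + Δ d          ≡⟨ rearrange j d (Δ j) (Δ d) ⟩
    j * j + (Δ j + Δ d + j * d)      ≡⟨ cong (j * j +_) (Δ-+ j d) ⟨
    j * j + Δ (j + d)                ∎
    where
    open ≤-Reasoning
    rearrange : ∀ j d x y → j * (j + d) + x + y ≡ j * j + (x + y + j * d)
    rearrange = solve-∀
  ... | inj₂ k≤j with d , refl ← m≤n⇒∃[o]m+o≡n k≤j = begin
    (k + d) * k + Δ (k + d)              ≡⟨ cong ((k + d) * k +_) (Δ-+ k d) ⟩
    (k + d) * k + (Δ k + Δ d + k * d)    ≤⟨ +-monoʳ-≤ ((k + d) * k) (+-monoˡ-≤ (k * d) (+-monoʳ-≤ (Δ k) (Δ[n]≤n*n d))) ⟩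
    (k + d) * k + (Δ k + d * d + k * d)  ≡⟨ rearrange k d (Δ k) ⟩
    (k + d) * (k + d) + Δ k              ∎
    where
    open ≤-Reasoning
    rearrange : ∀ k d x → (k + d) * k + (x + d * d + k * d) ≡ (k + d) * (k + d) + x
    rearrange = solve-∀

  Δ-tangent-suc : ∀ j k → j * k + Δ (suc j) ≤ j * j + Δ (suc k)
  Δ-tangent-suc j k = subst (_≤ j * j + Δ (suc k)) (rearrange j k (Δ j)) (Δ-tangent j (suc k))
    where
    rearrange : ∀ j k x → j * suc k + x ≡ j * k + (j + x)
    rearrange = solve-∀

  Δ-bracket : ∀ n → ∃[ K ] Δ (suc K) ≤ n × n < Δ (suc (suc K))
  Δ-bracket zero = 0 , z≤n , s≤s z≤n
  Δ-bracket (suc n) with K , Δ≤n , n<Δ ← Δ-bracket n with suc n <? Δ (suc (suc K))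
  ... | yes 1+n<Δ = K , m≤n⇒m≤1+n Δ≤n , 1+n<Δ
  ... | no  1+n≮Δ = suc K , ≮⇒≥ 1+n≮Δ , s≤s (≤-trans n<Δ (m≤n+m _ (suc K)))

module NatEmbedding where

  import Data.Nat as ℕ
  open import Data.Integer using (+_; +≤+)
  import Data.Integer as ℤ
  import Data.Integer.Properties as ℤP
  import Data.Nat.Coprimality as Coprime
  open import Data.Rational using (toℚᵘ; _+_; _*_; _-_; -_; _≤_)
  import Data.Rational.Properties as QP
  open import Data.Rational.Unnormalised as ℚᵘ using (mkℚᵘ; *≡*; *≤*)
  import Data.Rational.Unnormalised.Properties as ℚᵘP
  open import Tactic.RingSolver using (solve-∀)

  toℚᵘ-natQ : ∀ k → toℚᵘ (natQ k) ≡ mkℚᵘ (+ k) 0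
  toℚᵘ-natQ k = cong toℚᵘ (QP.normalize-coprime (Coprime.sym (Coprime.1-coprimeTo k)))

  natQ-+ : ∀ a b → natQ (a ℕ.+ b) ≡ natQ a + natQ b
  natQ-+ a b = QP.toℚᵘ-injective (begin
    toℚᵘ (natQ (a ℕ.+ b))                ≡⟨ toℚᵘ-natQ (a ℕ.+ b) ⟩
    mkℚᵘ (+ (a ℕ.+ b)) 0                 ≈⟨ *≡* (cong (ℤ._* + 1) (sym (cong₂ ℤ._+_ (ℤP.*-identityʳ (+ a))
                                                                                   (ℤP.*-identityʳ (+ b))))) ⟩
    mkℚᵘ (+ a) 0 ℚᵘ.+ mkℚᵘ (+ b) 0       ≡⟨ cong₂ ℚᵘ._+_ (toℚᵘ-natQ a) (toℚᵘ-natQ b) ⟨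
    toℚᵘ (natQ a) ℚᵘ.+ toℚᵘ (natQ b)     ≈⟨ QP.toℚᵘ-homo-+ (natQ a) (natQ b) ⟨
    toℚᵘ (natQ a + natQ b)               ∎)
    where open ℚᵘP.≃-Reasoning

  natQ-* : ∀ a b → natQ (a ℕ.* b) ≡ natQ a * natQ b
  natQ-* a b = QP.toℚᵘ-injective (begin
    toℚᵘ (natQ (a ℕ.* b))                ≡⟨ toℚᵘ-natQ (a ℕ.* b) ⟩
    mkℚᵘ (+ (a ℕ.* b)) 0                 ≈⟨ *≡* (cong (ℤ._* + 1) (ℤP.pos-* a b)) ⟩
    mkℚᵘ (+ a) 0 ℚᵘ.* mkℚᵘ (+ b) 0       ≡⟨ cong₂ ℚᵘ._*_ (toℚᵘ-natQ a) (toℚᵘ-natQ b) ⟨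
    toℚᵘ (natQ a) ℚᵘ.* toℚᵘ (natQ b)     ≈⟨ QP.toℚᵘ-homo-* (natQ a) (natQ b) ⟨
    toℚᵘ (natQ a * natQ b)               ∎)
    where open ℚᵘP.≃-Reasoning

  natQ-mono-≤ : ∀ {a b} → a ℕ.≤ b → natQ a ≤ natQ b
  natQ-mono-≤ {a} {b} a≤b = QP.toℚᵘ-cancel-≤ (subst₂ ℚᵘ._≤_ (sym (toℚᵘ-natQ a)) (sym (toℚᵘ-natQ b))
    (*≤* (ℤP.*-monoʳ-≤-nonNeg (+ 1) (+≤+ a≤b))))

  natQ-injective : ∀ {a b} → natQ a ≡ natQ b → a ≡ b
  natQ-injective {a} {b} eq = ℤP.+-injective (begin
    + a                 ≡⟨ cong ℚᵘ.↥_ (toℚᵘ-natQ a) ⟨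
    ℚᵘ.↥ toℚᵘ (natQ a)  ≡⟨ cong (λ q → ℚᵘ.↥ toℚᵘ q) eq ⟩
    ℚᵘ.↥ toℚᵘ (natQ b)  ≡⟨ cong ℚᵘ.↥_ (toℚᵘ-natQ b) ⟩
    + b                 ∎)
    where open ≡-Reasoning

  natQ-difference-≤ : ∀ {a b c d} → a ℕ.+ d ℕ.≤ c ℕ.+ b → natQ a - natQ b ≤ natQ c - natQ d
  natQ-difference-≤ {a} {b} {c} {d} a+d≤c+b =
    subst₂ _≤_ (cancelˡ (natQ a) (natQ b) (natQ d)) (cancelʳ (natQ c) (natQ b) (natQ d))
      (QP.+-monoˡ-≤ (- natQ b - natQ d)
        (subst₂ _≤_ (natQ-+ a d) (natQ-+ c b) (natQ-mono-≤ a+d≤c+b)))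
    where
    cancelˡ : ∀ x y z → x + z + (- y - z) ≡ x - y
    cancelˡ = solve-∀ ℚ-ring
    cancelʳ : ∀ x y z → x + y + (- y - z) ≡ x - z
    cancelʳ = solve-∀ ℚ-ring

module ConvexHull where

  open import Data.Nat using (zero; suc)
  open import Data.Fin using (Fin; zero; suc)
  open import Data.List as L using (List)
  open import Data.List.Relation.Unary.All as All using (All)
  open import Data.List.Relation.Unary.Any using (index)
  open import Data.List.Relation.Unary.Any.Properties using (lookup-index)
  open import Data.List.Membership.Propositional using (_∈_)
  open import Data.List.Membership.Propositional.Properties using (∈-lookup)
  open import Data.Rational using (ℚ; 0ℚ; 1ℚ; _+_; _*_; _-_; -_; _≤_; _<_; nonNegative; positive)
  import Data.Rational.Properties as QP
  open import Tactic.RingSolver using (solve-∀)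

  sumQ-cong : ∀ {m} {f g : Fin m → ℚ} → (∀ i → f i ≡ g i) → sumQ f ≡ sumQ g
  sumQ-cong {zero}  f≗g = refl
  sumQ-cong {suc m} f≗g = cong₂ _+_ (f≗g zero) (sumQ-cong (f≗g ∘ suc))

  sumQ-zero : ∀ {m} {f : Fin m → ℚ} → (∀ i → f i ≡ 0ℚ) → sumQ f ≡ 0ℚ
  sumQ-zero {zero}  f≗0 = refl
  sumQ-zero {suc m} f≗0 = trans (cong₂ _+_ (f≗0 zero) (sumQ-zero (f≗0 ∘ suc))) (QP.+-identityʳ 0ℚ)

  δ : ∀ {m} → Fin m → Fin m → ℚ
  δ zero    zero    = 1ℚ
  δ zero    (suc _) = 0ℚ
  δ (suc _) zero    = 0ℚ
  δ (suc i) (suc k) = δ i k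

  δ-nonNeg : ∀ {m} (i k : Fin m) → 0ℚ ≤ δ i k
  δ-nonNeg zero    zero    = QP.nonNegative⁻¹ 1ℚ
  δ-nonNeg zero    (suc _) = QP.≤-refl
  δ-nonNeg (suc _) zero    = QP.≤-refl
  δ-nonNeg (suc i) (suc k) = δ-nonNeg i k

  sumQ-δ : ∀ {m} (i : Fin m) (g : Fin m → ℚ) → sumQ (λ k → δ i k * g k) ≡ g i
  sumQ-δ zero g = begin
    1ℚ * g zero + sumQ (λ k → 0ℚ * g (suc k))  ≡⟨ cong₂ _+_ (QP.*-identityˡ (g zero)) (sumQ-zero (QP.*-zeroˡ ∘ g ∘ suc)) ⟩
    g zero + 0ℚ                                 ≡⟨ QP.+-identityʳ (g zero) ⟩
    g zero                                      ∎
    where open ≡-Reasoning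
  sumQ-δ (suc i) g = begin
    0ℚ * g zero + sumQ (λ k → δ i k * g (suc k))  ≡⟨ cong₂ _+_ (QP.*-zeroˡ (g zero)) (sumQ-δ i (g ∘ suc)) ⟩
    0ℚ + g (suc i)                                ≡⟨ QP.+-identityˡ (g (suc i)) ⟩
    g (suc i)                                     ∎
    where open ≡-Reasoning

  ∈⇒InConv : ∀ {P p} → p ∈ P → InConv P p
  ∈⇒InConv {P} {p} p∈P = δ i , δ-nonNeg i , total , coordinate proj₁ , coordinate proj₂
    where
    i = index p∈P
    total : sumQ (δ i) ≡ 1ℚ
    total = trans (sumQ-cong (sym ∘ QP.*-identityʳ ∘ δ i)) (sumQ-δ i (λ _ → 1ℚ))
    coordinate : (π : Point → ℚ) → sumQ (λ k → δ i k * π (L.lookup P k)) ≡ π p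
    coordinate π = trans (sumQ-δ i (π ∘ L.lookup P)) (cong π (sym (lookup-index p∈P)))

  φ : ℚ → Point → ℚ
  φ c (x , y) = c * x - y

  sumQ-weighted-≤ : ∀ {m} {w u : Fin m → ℚ} {M} → (∀ i → 0ℚ ≤ w i) → (∀ i → u i ≤ M) →
                    sumQ (λ i → w i * u i) ≤ M * sumQ w
  sumQ-weighted-≤ {zero}  {M = M} _ _ = QP.≤-reflexive (sym (QP.*-zeroʳ M))
  sumQ-weighted-≤ {suc m} {w} {u} {M} w≥0 u≤M = begin
    w zero * u zero + sumQ (λ i → w (suc i) * u (suc i))
      ≤⟨ QP.+-mono-≤ (QP.*-monoˡ-≤-nonNeg (w zero) {{nonNegative (w≥0 zero)}} (u≤M zero))
                     (sumQ-weighted-≤ (w≥0 ∘ suc) (u≤M ∘ suc)) ⟩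
    w zero * M + M * sumQ (w ∘ suc)  ≡⟨ factor (w zero) M (sumQ (w ∘ suc)) ⟩
    M * (w zero + sumQ (w ∘ suc))    ∎
    where
    open QP.≤-Reasoning
    factor : ∀ a M s → a * M + M * s ≡ M * (a + s)
    factor = solve-∀ ℚ-ring

  sumQ-φ : ∀ {m} c (w : Fin m → ℚ) (q : Fin m → Point) →
           sumQ (λ i → w i * φ c (q i)) ≡ c * sumQ (λ i → w i * proj₁ (q i)) - sumQ (λ i → w i * proj₂ (q i))
  sumQ-φ {zero}  c w q = annihilate c
    where
    annihilate : ∀ c → 0ℚ ≡ c * 0ℚ - 0ℚ
    annihilate = solve-∀ ℚ-ring
  sumQ-φ {suc m} c w q = begin
    w zero * φ c (q zero) + sumQ (λ i → w (suc i) * φ c (q (suc i)))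
      ≡⟨ cong (w zero * φ c (q zero) +_) (sumQ-φ c (w ∘ suc) (q ∘ suc)) ⟩
    w zero * φ c (q zero) + (c * X - Y)
      ≡⟨ distribute c (w zero) (proj₁ (q zero)) (proj₂ (q zero)) X Y ⟩
    c * (w zero * proj₁ (q zero) + X) - (w zero * proj₂ (q zero) + Y) ∎
    where
    open ≡-Reasoning
    X = sumQ (λ i → w (suc i) * proj₁ (q (suc i)))
    Y = sumQ (λ i → w (suc i) * proj₂ (q (suc i)))
    distribute : ∀ c a x y X Y → a * (c * x - y) + (c * X - Y) ≡ c * (a * x + X) - (a * y + Y)
    distribute = solve-∀ ℚ-ring

  φ-bounded-on-conv : ∀ {P} c {M a} → All (λ q → φ c q ≤ M) P → InConv P a → φ c a ≤ M
  φ-bounded-on-conv {P} c {M} {a₁ , a₂} bound (w , w≥0 , total , sum₁ , sum₂) = begin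
    c * a₁ - a₂                ≡⟨ cong₂ (λ x y → c * x - y) sum₁ sum₂ ⟨
    c * sumQ (λ i → w i * proj₁ (L.lookup P i)) - sumQ (λ i → w i * proj₂ (L.lookup P i))
                               ≡⟨ sumQ-φ c w (L.lookup P) ⟨
    sumQ (λ i → w i * φ c (L.lookup P i))
                               ≤⟨ sumQ-weighted-≤ w≥0 (λ i → All.lookup bound (∈-lookup i)) ⟩
    M * sumQ w                 ≡⟨ cong (M *_) total ⟩
    M * 1ℚ                     ≡⟨ QP.*-identityʳ M ⟩
    M                          ∎
    where open QP.≤-Reasoning

  convex-combination-at-bound : ∀ {t u v M} → 0ℚ < t → t < 1ℚ → u ≤ M → v ≤ M →
                                t * u + (1ℚ - t) * v ≡ M → u ≡ M × v ≡ M
  convex-combination-at-bound {t} {u} {v} {M} 0<t t<1 u≤M v≤M mean≡M =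
      QP.≤-antisym u≤M (QP.≮⇒≥ λ u<M → QP.<-irrefl mean≡M (begin-strict
        t * u + (1ℚ - t) * v  <⟨ QP.+-mono-<-≤ (QP.*-monoʳ-<-pos t {{positive 0<t}} u<M)
                                               (QP.*-monoˡ-≤-nonNeg (1ℚ - t) {{nonNegative (QP.<⇒≤ 0<1-t)}} v≤M) ⟩
        t * M + (1ℚ - t) * M  ≡⟨ recombine t M ⟩
        M                     ∎))
    , QP.≤-antisym v≤M (QP.≮⇒≥ λ v<M → QP.<-irrefl mean≡M (begin-strict
        t * u + (1ℚ - t) * v  <⟨ QP.+-mono-≤-< (QP.*-monoˡ-≤-nonNeg t {{nonNegative (QP.<⇒≤ 0<t)}} u≤M)
                                               (QP.*-monoʳ-<-pos (1ℚ - t) {{positive 0<1-t}} v<M) ⟩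
        t * M + (1ℚ - t) * M  ≡⟨ recombine t M ⟩
        M                     ∎))
    where
    open QP.≤-Reasoning
    0<1-t : 0ℚ < 1ℚ - t
    0<1-t = subst (_< 1ℚ - t) (QP.+-inverseʳ t) (QP.+-monoˡ-< (- t) t<1)
    recombine : ∀ t M → t * M + (1ℚ - t) * M ≡ M
    recombine = solve-∀ ℚ-ring

  φ-segPt : ∀ c t a b → φ c (segPt t a b) ≡ t * φ c a + (1ℚ - t) * φ c b
  φ-segPt c t (a₁ , a₂) (b₁ , b₂) = expand c t a₁ a₂ b₁ b₂
    where
    expand : ∀ c t a₁ a₂ b₁ b₂ →
      c * (t * a₁ + (1ℚ - t) * b₁) - (t * a₂ + (1ℚ - t) * b₂) ≡ t * (c * a₁ - a₂) + (1ℚ - t) * (c * b₁ - b₂)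
    expand = solve-∀ ℚ-ring

  φ-pred : ∀ c x y → φ (c - 1ℚ) (x , y) ≡ c * x - (x + y)
  φ-pred = expand
    where
    expand : ∀ c x y → (c - 1ℚ) * x - y ≡ c * x - (x + y)
    expand = solve-∀ ℚ-ring

  φ-injective₂ : ∀ c {a p} → φ c a ≡ φ c p → φ (c - 1ℚ) a ≡ φ (c - 1ℚ) p → a ≡ p
  φ-injective₂ c {a₁ , a₂} {p₁ , p₂} eq eq′ = cong₂ _,_ a₁≡p₁ a₂≡p₂
    where
    abscissa : ∀ c x y → (c * x - y) - ((c - 1ℚ) * x - y) ≡ x
    abscissa = solve-∀ ℚ-ring
    ordinate : ∀ c x y → c * x - (c * x - y) ≡ y
    ordinate = solve-∀ ℚ-ring
    a₁≡p₁ : a₁ ≡ p₁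
    a₁≡p₁ = trans (sym (abscissa c a₁ a₂)) (trans (cong₂ _-_ eq eq′) (abscissa c p₁ p₂))
    a₂≡p₂ : a₂ ≡ p₂
    a₂≡p₂ = trans (sym (ordinate c a₁ a₂)) (trans (cong₂ (λ x v → c * x - v) a₁≡p₁ eq) (ordinate c p₁ p₂))

  Maximises : ℚ → List Point → Point → Set
  Maximises c P p = All (λ q → φ c q ≤ φ c p) P

  maximiser-segment-ends : ∀ c {P p a b t} → Maximises c P p → InConv P a → InConv P b →
                           0ℚ < t → t < 1ℚ → p ≡ segPt t a b → φ c a ≡ φ c p × φ c b ≡ φ c p
  maximiser-segment-ends c {a = a} {b = b} {t} max a∈ b∈ 0<t t<1 p≡ =
    convex-combination-at-bound 0<t t<1 (φ-bounded-on-conv c max a∈) (φ-bounded-on-conv c max b∈)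
      (sym (trans (cong (φ c) p≡) (φ-segPt c t a b)))

  maximises-two-slopes⇒IsVertex : ∀ {P p} c → InConv P p → Maximises c P p → Maximises (c - 1ℚ) P p → IsVertex P p
  maximises-two-slopes⇒IsVertex c p∈ max max′ = p∈ , λ a b t a∈ b∈ 0<t t<1 p≡ →
    let φa , φb = maximiser-segment-ends c max a∈ b∈ 0<t t<1 p≡
        φ′a , φ′b = maximiser-segment-ends (c - 1ℚ) max′ a∈ b∈ 0<t t<1 p≡
    in trans (φ-injective₂ c φa φ′a) (sym (φ-injective₂ c φb φ′b))

module Parabola where

  import Data.Nat as ℕ
  open import Data.Nat using (ℕ; suc)
  import Data.List as L
  open import Data.List.Relation.Unary.All as All using ()
  open import Data.List.Relation.Unary.All.Properties using (map⁺)
  open import Data.List.Membership.Propositional using (_∈_)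
  open import Data.List.Membership.Propositional.Properties using (∈-map⁺)
  open import Data.Rational using (1ℚ; _-_; _≤_)
  open Triangular
  open NatEmbedding
  open ConvexHull

  parabola : ℕ → Point
  parabola j = natQ j , natQ (Δ j)

  parabola-injective : ∀ {j k} → parabola j ≡ parabola k → j ≡ k
  parabola-injective = natQ-injective ∘ cong proj₁

  φ-parabola-≤ : ∀ j k → φ (natQ j) (parabola k) ≤ φ (natQ j) (parabola j)
  φ-parabola-≤ j k = subst₂ _≤_ (value k) (value j)
    (natQ-difference-≤ {j ℕ.* k} {Δ k} {j ℕ.* j} {Δ j} (Δ-tangent j k))
    where
    value : ∀ k → natQ (j ℕ.* k) - natQ (Δ k) ≡ φ (natQ j) (parabola k)
    value k = cong (_- natQ (Δ k)) (natQ-* j k)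

  φ-pred-parabola-≤ : ∀ j k → φ (natQ j - 1ℚ) (parabola k) ≤ φ (natQ j - 1ℚ) (parabola j)
  φ-pred-parabola-≤ j k = subst₂ _≤_ (value k) (value j)
    (natQ-difference-≤ {j ℕ.* k} {Δ (suc k)} {j ℕ.* j} {Δ (suc j)} (Δ-tangent-suc j k))
    where
    value : ∀ k → natQ (j ℕ.* k) - natQ (Δ (suc k)) ≡ φ (natQ j - 1ℚ) (parabola k)
    value k = trans (cong₂ _-_ (natQ-* j k) (natQ-+ k (Δ k))) (sym (φ-pred (natQ j) (natQ k) (natQ (Δ k))))

  parabola-isVertex : ∀ {j ks} → j ∈ ks → IsVertex (L.map parabola ks) (parabola j)
  parabola-isVertex {j} {ks} j∈ks =
    maximises-two-slopes⇒IsVertex (natQ j) (∈⇒InConv (∈-map⁺ parabola j∈ks))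
      (map⁺ (All.universal (φ-parabola-≤ j) ks))
      (map⁺ (All.universal (φ-pred-parabola-≤ j) ks))

module Encoding where

  open import Data.Nat
  open import Data.Nat.Properties using (+-identityʳ)
  open import Data.Bool using (Bool; true; false)
  open import Data.Vec using (Vec; []; _∷_; _++_; replicate)
  open Triangular
  open Parabola

  unary : ℕ → (m : ℕ) → Vec Bool m
  unary _       zero    = []
  unary zero    (suc m) = false ∷ unary zero m
  unary (suc j) (suc m) = true ∷ unary j m

  dot-++ : ∀ {a b} (u v : Vec Bool a) (u′ v′ : Vec Bool b) → dot (u ++ u′) (v ++ v′) ≡ dot u v + dot u′ v′
  dot-++ []          []          u′ v′ = refl
  dot-++ (true ∷ u)  (true ∷ v)  u′ v′ = cong suc (dot-++ u v u′ v′)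
  dot-++ (true ∷ u)  (false ∷ v) u′ v′ = dot-++ u v u′ v′
  dot-++ (false ∷ u) (_ ∷ v)     u′ v′ = dot-++ u v u′ v′

  dot-falses : ∀ {m} (v : Vec Bool m) → dot (replicate m false) v ≡ 0
  dot-falses []      = refl
  dot-falses (_ ∷ v) = dot-falses v

  dot-trues-unary : ∀ {j m} → j ≤ m → dot (replicate m true) (unary j m) ≡ j
  dot-trues-unary {zero}  {zero}  z≤n       = refl
  dot-trues-unary {zero}  {suc m} z≤n       = dot-trues-unary {zero} {m} z≤n
  dot-trues-unary {suc j} {suc m} (s≤s j≤m) = cong suc (dot-trues-unary j≤m)

  blocks : ∀ K R → Vec (Vec Bool (K + R)) 2
  blocks K R = (replicate K true ++ replicate R false) ∷ (replicate K false ++ replicate R true) ∷ []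

  encode : ∀ K R → ℕ → Vec Bool (K + R)
  encode K R j = unary j K ++ unary (Δ j) R

  project-encode : ∀ {K R j} → j ≤ K → Δ j ≤ R → project (blocks K R) (encode K R j) ≡ parabola j
  project-encode {K} {R} {j} j≤K Δj≤R = cong₂ _,_ (cong natQ first) (cong natQ second)
    where
    first : dot (replicate K true ++ replicate R false) (encode K R j) ≡ j
    first = begin
      dot (replicate K true ++ replicate R false) (unary j K ++ unary (Δ j) R)
        ≡⟨ dot-++ (replicate K true) (unary j K) (replicate R false) (unary (Δ j) R) ⟩
      dot (replicate K true) (unary j K) + dot (replicate R false) (unary (Δ j) R)
        ≡⟨ cong₂ _+_ (dot-trues-unary j≤K) (dot-falses (unary (Δ j) R)) ⟩
      j + 0
        ≡⟨ +-identityʳ j ⟩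
      j ∎
      where open ≡-Reasoning
    second : dot (replicate K false ++ replicate R true) (encode K R j) ≡ Δ j
    second = begin
      dot (replicate K false ++ replicate R true) (unary j K ++ unary (Δ j) R)
        ≡⟨ dot-++ (replicate K false) (unary j K) (replicate R true) (unary (Δ j) R) ⟩
      dot (replicate K false) (unary j K) + dot (replicate R true) (unary (Δ j) R)
        ≡⟨ cong₂ _+_ (dot-falses (unary j K)) (dot-trues-unary Δj≤R) ⟩
      Δ j ∎
      where open ≡-Reasoning

open import Data.Nat using (ℕ; suc; s≤s; _<_; _≤_; _+_; _*_; _∸_)
open import Data.Nat.Properties using (≤-trans; <-≤-trans; m≤m+n; +-assoc; m+[n∸m]≡n)
open import Data.Bool using (Bool)
open import Data.Vec using (Vec)
open import Data.List using (List; length; map; upTo)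
open import Data.List.Properties using (map-∘; map-cong-local; length-map; length-upTo)
open import Data.List.Relation.Unary.All as All using (All)
open import Data.List.Relation.Unary.All.Properties using (all-upTo; map⁺)
open import Data.List.Relation.Unary.Unique.Propositional using (Unique)
import Data.List.Relation.Unary.Unique.Propositional.Properties as Unique
open Triangular
open Parabola
open Encoding

ProjectedVertices : ℕ → ℕ → Set
ProjectedVertices n m =
  Σ (List (Vec Bool n)) λ S →
  Σ (Vec (Vec Bool n) 2) λ W →
  Σ (List Point) λ V →
    Unique V × All (IsVertex (image W S)) V × length V ≡ m

parabola-projection : ∀ K R → Δ K ≤ R → ProjectedVertices (K + R) (suc K)
parabola-projection K R ΔK≤R = S , W , V , unique , vertices , length-V
  where
  js = upTo (suc K)
  W = blocks K R
  S = map (encode K R) js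
  V = map parabola js
  encodes : ∀ {j} → j < suc K → project W (encode K R j) ≡ parabola j
  encodes (s≤s j≤K) = project-encode j≤K (≤-trans (Δ-mono-≤ j≤K) ΔK≤R)
  image≡V : image W S ≡ V
  image≡V = trans (sym (map-∘ js))
    (map-cong-local {f = project W ∘ encode K R} (All.map encodes (all-upTo (suc K))))
  unique : Unique V
  unique = Unique.map⁺ parabola-injective (Unique.upTo⁺ (suc K))
  vertices : All (IsVertex (image W S)) V
  vertices = subst (λ Q → All (IsVertex Q) V) (sym image≡V)
    (map⁺ {xs = js} (All.tabulate parabola-isVertex))
  length-V : length V ≡ suc K
  length-V = trans (length-map parabola js) (length-upTo (suc K))

projection-in-dimension : ∀ {n} K → Δ (suc K) ≤ n → ProjectedVertices n (suc K)
projection-in-dimension {n} K Δ≤n =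
  subst (λ m → ProjectedVertices m (suc K)) dimension (parabola-projection K (Δ K + R) (m≤m+n (Δ K) R))
  where
  R = n ∸ Δ (suc K)
  dimension : K + (Δ K + R) ≡ n
  dimension = trans (sym (+-assoc K (Δ K) R)) (m+[n∸m]≡n Δ≤n)

-- The construction works for every n.
theorem3p1 : (n : ℕ) → 1 ≤ n →
    Σ (List (Vec Bool n)) λ S →
    Σ (Vec (Vec Bool n) 2) λ W →
    Σ (List Point) λ V →
    Unique V × All (IsVertex (image W S)) V × n < 2 * length V * length V
theorem3p1 n _ =
  let K , Δ≤n , n<Δ = Δ-bracket n
      S , W , V , unique , vertices , |V|≡1+K = projection-in-dimension K Δ≤n
  in  S , W , V , unique , vertices ,
      subst (λ l → n < 2 * l * l) (sym |V|≡1+K) (<-≤-trans n<Δ (Δ[1+n]≤2*n*n (suc K)))
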